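{- Let $\mathcal{K}=(S,s_\mathit{init},\mathbb{D},\kappa,\ell)$ be a Kripke structure over $\mathit{AP}$, let $\varphi=\mathds{Q}_1\pi_1\ldots\mathds{Q}_n\pi_n.\psi$ be a HyperLTL formula with arbitrary quantifiers $\mathds{Q}_i\in\{\forall,\exists\}$, and let $\mathcal{A}_\psi$ be any deterministic parity automaton over $2^{\mathit{AP}_\psi}$ recognizing $\psi$. Let $\mathcal{G}_{\mathcal{K},\varphi}$ be the multiplayer parity game under incomplete information constructed from $\mathcal{K},\varphi,\mathcal{A}_\psi$ as described in the context, and let $\mathbb{P}_\exists=\{i\in\{1,\ldots,n\}\mid \mathds{Q}_i=\exists\}$. If the coalition $\mathbb{P}_\exists$ wins $\mathcal{G}_{\mathcal{K},\varphi}$, then $\mathcal{K}\models\varphi$.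
   Context: A Kripke structure (KS) over a finite set $\mathit{AP}$ of atomic propositions is $\mathcal{K}=(S,s_\mathit{init},\mathbb{D},\kappa,\ell)$ with finite state set $S$, initial state $s_\mathit{init}\notin S$, finite set of directions $\mathbb{D}$, transition function $\kappa:(S\uplus\{s_\mathit{init}\})\times\mathbb{D}\to S$ and labeling $\ell:(S\uplus\{s_\mathit{init}\})\to 2^{\mathit{AP}}$. A path is an infinite sequence $\tau$ with $\tau(0)=s_\mathit{init}$ and, for all $i$, $\tau(i+1)=\kappa(\tau(i),d)$ for some $d\in\mathbb{D}$; its trace is $\ell(\tau(0))\ell(\tau(1))\cdots$, and $\mathit{Traces}(\mathcal{K})$ is the set of traces of all paths. HyperLTL: with trace variables $\pi_1,\ldots,\pi_n$, a formula is $\varphi=\mathds{Q}_1\pi_1\ldots\mathds{Q}_n\pi_n.\psi$ where $\psi$ is an LTL formula (operators $\neg,\land,\mathsf{X},\mathsf{U}$, standard semantics) over the indexed propositions $\mathit{AP}_\psi=\{a_{\pi_i}\mid a\in\mathit{AP},1\le i\le n\}$. Given traces $t_1,\dots,t_n$, $\psi$ is evaluated on the combined word $w\in(2^{\mathit{AP}_\psi})^\omega$ with $w(j)=\bigcup_i\{a_{\pi_i}\mid a\in t_i(j)\}$. $\mathcal{K}\models\varphi$ is defined by the usual first-order reading: $\forall\pi_i$ ranges over all traces of $\mathit{Traces}(\mathcal{K})$, $\exists\pi_i$ requires some trace in $\mathit{Traces}(\mathcal{K})$, and finally the combined word must satisfy $\psi$. A deterministic parity automaton (DPA) $\mathcal{A}_\psi=(2^{\mathit{AP}_\psi},Q_\psi,q_{0,\psi},\delta_\psi,c_\psi)$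 has transition function $\delta_\psi:Q_\psi\times 2^{\mathit{AP}_\psi}\to Q_\psi$ and coloring $c_\psi:Q_\psi\to\mathbb{N}$; it accepts a word iff on its unique run the minimal color occurring infinitely often is even; it recognizes $\psi$ if it accepts exactly the words satisfying $\psi$. A multiplayer parity game under incomplete information (MPG$_{ii}$) is $\mathcal{G}=(\mathbb{P},\{V_p\}_{p\in\mathbb{P}},v_\mathit{init},\mathbb{D},E,\{\sim_p\}_{p\in\mathbb{P}},c)$: finite player set $\mathbb{P}$, pairwise disjoint vertex sets $V_p$ with $V=\biguplus_p V_p$, initial vertex $v_\mathit{init}$, directions $\mathbb{D}$, transition function $E:V\times\mathbb{D}\to V$, equivalence relations $\sim_p\subseteq V\times V$ (with $v\sim_p v'$ implying either both or neither lie in $V_p$), and coloring $c:V\to\mathbb{N}$. Finite plays $\rho_1,\rho_2\in V^*$ satisfy $\rho_1\sim_p\rho_2$ if they have equal length and are pointwise $\sim_p$-related. A strategy for $p$ is $\sigma_p:V^*\cdot V_p\to\mathbb{D}$ with $\sigma_p(\rho_1)=\sigma_p(\rho_2)$ whenever $\rho_1\sim_p\rho_2$. A family $\{\sigma_p\}_{p\in\mathbb{P}}$ determines the unique play $\rho$ with $\rho(0)=v_\mathit{init}$ and $\rho(i+1)=E(\rho(i),\sigma_p(\rho[0,i]))$ where $\rho(i)\in V_p$. A play is even if the minimal color occurring infinitely often is even. A coalition $A\subseteq\mathbb{P}$ wins $\mathcal{G}$ if there are strategies $\{\sigma_p\}_{p\in A}$ such that for all strategies $\{\sigma_p\}_{p\in\mathbb{P}\setminus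 A}$ the resulting play is even. The game $\mathcal{G}_{\mathcal{K},\varphi}$: $\mathbb{P}=\{1,\dots,n\}$; $V_p=\{\langle s_1,\ldots,s_n,q,p\rangle\mid s_i\in S\uplus\{s_\mathit{init}\},q\in Q_\psi\}$; $v_\mathit{init}=\langle s_\mathit{init},\ldots,s_\mathit{init},q_{0,\psi},1\rangle$; directions $\mathbb{D}$ of $\mathcal{K}$; with $\mathit{nxt}(p)=p+1$ for $p<n$ and $\mathit{nxt}(n)=1$, for $p>1$: $E(\langle s_1,\ldots,s_n,q,p\rangle,d)=\langle s_1,\ldots,s_{p-1},\kappa(s_p,d),s_{p+1},\ldots,s_n,q,\mathit{nxt}(p)\rangle$, and $E(\langle s_1,\ldots,s_n,q,1\rangle,d)=\langle \kappa(s_1,d),s_2,\ldots,s_n,\delta_\psi(q,\bigcup_{i=1}^n\{a_{\pi_i}\mid a\in\ell(s_i)\}),\mathit{nxt}(1)\rangle$; $\langle s_1,\ldots,s_n,q,p'\rangle\sim_p\langle s'_1,\ldots,s'_n,q',p''\rangle$ iff $p'=p''$ and $s_j=s'_j$ for all $1\le j\le p$; $c(\langle s_1,\ldots,s_n,q,p\rangle)=c_\psi(q)$. -}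

module Defs where

open import Data.Nat as ℕ using (ℕ; zero; suc; _≤_; _<?_)
open import Data.Nat.Divisibility using (_∣_)
open import Data.Fin using (Fin; zero; suc; toℕ; fromℕ<)
open import Data.Fin.Subset using (Subset; _∈_)
open import Data.Vec using (Vec; []; _∷_; lookup; map; last; _∷ʳ_; updateAt)
open import Data.Maybe using (Maybe; just; nothing)
open import Data.Bool using (Bool; true; false; T; not)
open import Data.Unit using (tt)
open import Data.Product using (Σ; ∃; _×_; _,_; proj₁)
open import Relation.Nullary using (¬_; yes; no)
open import Relation.Binary.PropositionalEquality using (_≡_)

InfOften : (ℕ → Set) → Set
InfOften P = ∀ i → ∃ λ j → i ≤ j × P j

-- the minimal colour occurring infinitely often in a colour sequence is
-- even: some even colour c occurs infinitely often and from some point on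
-- all colours are ≥ c.
MinInfEven : (ℕ → ℕ) → Set
MinInfEven col = ∃ λ c → (2 ∣ c) × InfOften (λ j → col j ≡ c)
                          × ∃ λ N → ∀ j → N ≤ j → c ≤ col j

-- Kripke structures.  AP = Fin a, S = Fin m, s_init = nothing,
-- S ⊎ {s_init} = Maybe (Fin m), directions D = Fin d.

record Kripke (a : ℕ) : Set where
  field
    m   : ℕ
    d   : ℕ
    κ   : Maybe (Fin m) → Fin d → Fin m
    ℓ   : Maybe (Fin m) → Subset a

Trace : ℕ → Set
Trace a = ℕ → Subset a

IsTrace : ∀ {a} → Kripke a → Trace a → Set
IsTrace K t = ∃ λ (τ : ℕ → Maybe (Fin m)) →
     (τ 0 ≡ nothing)
   × (∀ i → ∃ λ (dir : Fin d) → τ (suc i) ≡ just (κ (τ i) dir))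
   × (∀ i → t i ≡ ℓ (τ i))
  where open Kripke K

-- LTL over AP_ψ = { x_{π_i} | x ∈ AP, i ∈ Fin n }.
-- A letter of 2^{AP_ψ} is a vector (indexed by i) of subsets of AP.

Letter : ℕ → ℕ → Set
Letter n a = Vec (Subset a) n

data LTL (n a : ℕ) : Set where
  atom : Fin n → Fin a → LTL n a
  ¬ₗ_  : LTL n a → LTL n a
  _∧ₗ_ : LTL n a → LTL n a → LTL n a
  Xₗ   : LTL n a → LTL n a
  _Uₗ_ : LTL n a → LTL n a → LTL n a

_,_⊨_ : ∀ {n a} → (ℕ → Letter n a) → ℕ → LTL n a → Set
w , j ⊨ atom i x = x ∈ lookup (w j) i
w , j ⊨ (¬ₗ ψ) = ¬ (w , j ⊨ ψ)
w , j ⊨ (ψ₁ ∧ₗ ψ₂) = (w , j ⊨ ψ₁) × (w , j ⊨ ψ₂)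
w , j ⊨ Xₗ ψ = w , suc j ⊨ ψ
w , j ⊨ (ψ₁ Uₗ ψ₂) = ∃ λ k → j ≤ k × (w , k ⊨ ψ₂)
                         × (∀ l → j ≤ l → l ℕ.< k → w , l ⊨ ψ₁)

combine : ∀ {n a} → Vec (Trace a) n → ℕ → Letter n a
combine ts j = map (λ t → t j) ts

data Quant : Set where
  ∀q ∃q : Quant

Holds : ∀ {a j} → Kripke a → Vec Quant j → (Vec (Trace a) j → Set) → Set
Holds K [] P = P []
Holds K (∀q ∷ qs) P = ∀ t → IsTrace K t → Holds K qs (λ ts → P (t ∷ ts))
Holds K (∃q ∷ qs) P = ∃ λ t → IsTrace K t × Holds K qs (λ ts → P (t ∷ ts))

record HyperLTL (n a : ℕ) : Set where
  constructor _∙_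
  field
    quants : Vec Quant n
    body   : LTL n a

_⊨ₕ_ : ∀ {n a} → Kripke a → HyperLTL n a → Set
K ⊨ₕ (qs ∙ ψ) = Holds K qs (λ ts → combine ts , 0 ⊨ ψ)

isExists : Quant → Bool
isExists ∀q = false
isExists ∃q = true

record DPA (n a : ℕ) : Set where
  field
    nQ : ℕ
    q₀ : Fin nQ
    δ  : Fin nQ → Letter n a → Fin nQ
    c  : Fin nQ → ℕ

  run : (ℕ → Letter n a) → ℕ → Fin nQ
  run w zero = q₀
  run w (suc i) = δ (run w i) (w i)

  Accepts : (ℕ → Letter n a) → Set
  Accepts w = MinInfEven (λ i → c (run w i))

Recognizes : ∀ {n a} → DPA n a → LTL n a → Set
Recognizes A ψ = ∀ w → (DPA.Accepts A w → w , 0 ⊨ ψ) × (w , 0 ⊨ ψ → DPA.Accepts A w)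

-- Multiplayer parity games under incomplete information.
-- Players = Fin nP; V_p = { v | owner v ≡ p } (pairwise disjoint, cover V).

record MPG : Set₁ where
  field
    nP    : ℕ
    V     : Set
    owner : V → Fin nP
    vinit : V
    Dir   : Set
    E     : V → Dir → V
    sim   : Fin nP → V → V → Set
    col   : V → ℕ

  -- strategies, defined on finite plays ρ ∈ V⁺ (only the values on plays
  -- ending in V_p are ever used)
  Strategy : Set
  Strategy = ∀ {k} → Vec V (suc k) → Dir

  Consistent : Fin nP → Strategy → Set
  Consistent p σ = ∀ {k} (ρ₁ ρ₂ : Vec V (suc k)) → owner (last ρ₁) ≡ p →
                   (∀ i → sim p (lookup ρ₁ i) (lookup ρ₂ i)) → σ ρ₁ ≡ σ ρ₂

  CStrat : Fin nP → Set
  CStrat p = Σ Strategy (Consistent p)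

  hist : (Fin nP → Strategy) → (k : ℕ) → Vec V (suc k)
  hist σ zero = vinit ∷ []
  hist σ (suc k) = hist σ k ∷ʳ E (last (hist σ k)) (σ (owner (last (hist σ k))) (hist σ k))

  play : (Fin nP → Strategy) → ℕ → V
  play σ i = last (hist σ i)

  pick : {X : Set} (b : Bool) → (T b → X) → (T (not b) → X) → X
  pick true f g = f tt
  pick false f g = g tt

  Wins : (Fin nP → Bool) → Set
  Wins A = Σ ((p : Fin nP) → T (A p) → CStrat p) λ σA →
           (σO : (p : Fin nP) → T (not (A p)) → CStrat p) →
           MinInfEven (λ i → col (play (λ p → proj₁ (pick (A p) (σA p) (σO p))) i))

-- The game G_{K,φ}  (n = suc n' ≥ 1 players; player 1 = zero)

nxt : ∀ {k} → Fin (suc k) → Fin (suc k)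
nxt {k} p with toℕ p <? k
... | yes lt = suc (fromℕ< lt)
... | no _ = zero

module _ {n' a : ℕ} (K : Kripke a) (φ : HyperLTL (suc n') a) (𝒜 : DPA (suc n') a) where
  open Kripke K
  open DPA 𝒜

  GVert : Set
  GVert = Vec (Maybe (Fin m)) (suc n') × Fin nQ × Fin (suc n')

  GE : GVert → Fin d → GVert
  GE (ss , q , zero) dir =
    (updateAt ss zero (λ s → just (κ s dir)) , δ q (map ℓ ss) , nxt zero)
  GE (ss , q , suc p) dir =
    (updateAt ss (suc p) (λ s → just (κ s dir)) , q , nxt (suc p))

  Gsim : Fin (suc n') → GVert → GVert → Set
  Gsim p (ss , q , p′) (ss′ , q′ , p″) =
    (p′ ≡ p″) × (∀ j → toℕ j ≤ toℕ p → lookup ss j ≡ lookup ss′ j)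

  Game : MPG
  Game = record
    { nP    = suc n'
    ; V     = GVert
    ; owner = λ v → Data.Product.proj₂ (Data.Product.proj₂ v)
    ; vinit = (Data.Vec.replicate (suc n') nothing , q₀ , zero)
    ; Dir   = Fin d
    ; E     = GE
    ; sim   = Gsim
    ; col   = λ v → c (proj₁ (Data.Product.proj₂ v))
    }
    where import Data.Vec; import Data.Product

-- Fix a winning strategy of the existential players and let every universal
-- player follow some direction sequence.  The play then proceeds in rounds of
-- n moves in which player i extends its own path of K by one step, and the
-- automaton reads the combined letter of the round when player 1 moves; so if
-- the play is even, 𝒜 accepts the combined word of the n traces, which hence
-- satisfies ψ.  Since player i only observes the paths of players 1, …, i, its
-- trace depends only on the directions of the earlier universal players: the
-- strategy is a causal Skolem function for the quantifier prefix, and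
-- instantiating it quantifier by quantifier proves K ⊨ φ.

module Submission where

open import Defs
open import Data.Nat using (ℕ; zero; suc; _+_; _*_; _≤_; _<_; _<?_; z≤n; s≤s; NonZero)
open import Data.Nat.Properties
open import Data.Nat.DivMod
open import Data.Nat.Divisibility using (n∣m*n)
open import Data.Fin using (Fin; zero; suc; toℕ) renaming (_≟_ to _≟ᶠ_)
open import Data.Fin.Properties using (toℕ-injective; toℕ-fromℕ<; toℕ<n)
open import Data.Fin.Subset using (_∈_)
open import Data.Vec using (Vec; []; _∷_; lookup; map; last; _∷ʳ_; tabulate)
open import Data.Vec.Properties
  using (lookup∘updateAt; lookup∘updateAt′; lookup-replicate; last-∷ʳ;
         tabulate∘lookup; tabulate-∘; tabulate-cong)
open import Data.Maybe using (Maybe; nothing; just)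
open import Data.Bool using (Bool; true; false; T; not)
open import Data.Unit using (tt)
open import Data.Empty using (⊥-elim)
open import Data.Product using (∃; _×_; _,_; proj₁; proj₂)
open import Function using (_∘_)
open import Relation.Nullary using (yes; no)
open import Relation.Binary.PropositionalEquality

[m*n+o]%n≡o : ∀ m {n o} .{{_ : NonZero n}} → o < n → (m * n + o) % n ≡ o
[m*n+o]%n≡o m {n} {o} o<n = begin
  (m * n + o) % n ≡⟨ cong (_% n) (+-comm (m * n) o) ⟩
  (o + m * n) % n ≡⟨ [m+kn]%n≡m%n o m n ⟩
  o % n           ≡⟨ m<n⇒m%n≡m o<n ⟩
  o               ∎
  where open ≡-Reasoning

[m*n+o]/n≡m : ∀ m {n o} .{{_ : NonZero n}} → o < n → (m * n + o) / n ≡ m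
[m*n+o]/n≡m m {n} {o} o<n = begin
  (m * n + o) / n   ≡⟨ +-distrib-/-∣ˡ o (n∣m*n m) ⟩
  m * n / n + o / n ≡⟨ cong₂ _+_ (m*n/n≡m m n) (m<n⇒m/n≡0 o<n) ⟩
  m + 0             ≡⟨ +-identityʳ m ⟩
  m                 ∎
  where open ≡-Reasoning

[1+m%n]%n≡[1+m]%n : ∀ m n .{{_ : NonZero n}} → suc (m % n) % n ≡ suc m % n
[1+m%n]%n≡[1+m]%n m n = begin
  (1 + m % n) % n         ≡⟨ %-distribˡ-+ 1 (m % n) n ⟩
  (1 % n + m % n % n) % n ≡⟨ cong (λ x → (1 % n + x) % n) (m%n%n≡m%n m n) ⟩
  (1 % n + m % n) % n     ≡⟨ %-distribˡ-+ 1 m n ⟨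
  (1 + m) % n             ∎
  where open ≡-Reasoning

m≡[m/n]*n+m%n : ∀ m n .{{_ : NonZero n}} → m ≡ m / n * n + m % n
m≡[m/n]*n+m%n m n = trans (m≡m%n+[m/n]*n m n) (+-comm (m % n) (m / n * n))

m*n≤o⇒m≤o/n : ∀ m {n o} .{{_ : NonZero n}} → m * n ≤ o → m ≤ o / n
m*n≤o⇒m≤o/n m {n} m*n≤o = subst (_≤ _) (m*n/n≡m m n) (/-monoˡ-≤ n m*n≤o)

toℕ-nxt : ∀ {k} (x : Fin (suc k)) → toℕ (nxt x) ≡ suc (toℕ x) % suc k
toℕ-nxt {k} x with toℕ x <? k
... | yes x<k = trans (cong suc (toℕ-fromℕ< x<k)) (sym (m<n⇒m%n≡m (s≤s x<k)))
... | no x≮k = sym (trans (cong (λ y → suc y % suc k) x≡k) (n%n≡0 (suc k)))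
  where
  x≡k : toℕ x ≡ k
  x≡k = ≤-antisym (≤-pred (toℕ<n x)) (≮⇒≥ x≮k)

module _ {A B : Set} (R : A → B → Set) where

  ∷ʳ-pointwise : ∀ {k} (xs : Vec A k) (ys : Vec B k) {x y} →
                 (∀ i → R (lookup xs i) (lookup ys i)) → R x y →
                 ∀ i → R (lookup (xs ∷ʳ x) i) (lookup (ys ∷ʳ y) i)
  ∷ʳ-pointwise []       []       _     x~y zero    = x~y
  ∷ʳ-pointwise (_ ∷ _)  (_ ∷ _)  xs~ys _   zero    = xs~ys zero
  ∷ʳ-pointwise (_ ∷ xs) (_ ∷ ys) xs~ys x~y (suc i) = ∷ʳ-pointwise xs ys (xs~ys ∘ suc) x~y i

  last-pointwise : ∀ {k} (xs : Vec A (suc k)) (ys : Vec B (suc k)) →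
                   (∀ i → R (lookup xs i) (lookup ys i)) → R (last xs) (last ys)
  last-pointwise {zero}  (_ ∷ [])  (_ ∷ [])  xs~ys = xs~ys zero
  last-pointwise {suc k} (_ ∷ xs) (_ ∷ ys) xs~ys = last-pointwise xs ys (xs~ys ∘ suc)

MinInfEven-transfer : ∀ {f g : ℕ → ℕ} →
  (∀ r → ∃ λ i → r ≤ i × g i ≡ f r) →
  (∀ r → ∃ λ k → ∀ i → k ≤ i → ∃ λ r′ → r ≤ r′ × g i ≡ f r′) →
  MinInfEven g → MinInfEven f
MinInfEven-transfer {f} {g} embed cofinal (c , even , often , N , above) =
  c , even , often′ , N , above′
  where
  often′ : InfOften (λ r → f r ≡ c)
  often′ r =
    let k , covers = cofinal r
        i , k≤i , gi≡c = often k
        r′ , r≤r′ , gi≡fr′ = covers i k≤i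
    in r′ , r≤r′ , trans (sym gi≡fr′) gi≡c
  above′ : ∀ r → N ≤ r → c ≤ f r
  above′ r N≤r =
    let i , r≤i , gi≡fr = embed r in subst (c ≤_) gi≡fr (above i (≤-trans N≤r r≤i))

⊨-resp : ∀ {n a} {w w′ : ℕ → Letter n a} → (∀ j → w j ≡ w′ j) →
         ∀ ψ j → w , j ⊨ ψ → w′ , j ⊨ ψ
⊨-resp w≗w′ (atom i x) j h = subst (λ l → x ∈ lookup l i) (w≗w′ j) h
⊨-resp w≗w′ (¬ₗ ψ) j h h′ = h (⊨-resp (sym ∘ w≗w′) ψ j h′)
⊨-resp w≗w′ (ψ₁ ∧ₗ ψ₂) j (h₁ , h₂) = ⊨-resp w≗w′ ψ₁ j h₁ , ⊨-resp w≗w′ ψ₂ j h₂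
⊨-resp w≗w′ (Xₗ ψ) j h = ⊨-resp w≗w′ ψ (suc j) h
⊨-resp w≗w′ (ψ₁ Uₗ ψ₂) j (k , j≤k , h₂ , h₁) =
  k , j≤k , ⊨-resp w≗w′ ψ₂ k h₂ , λ l j≤l l<k → ⊨-resp w≗w′ ψ₁ l (h₁ l j≤l l<k)

Extensional : ∀ {a j} → (Vec (Trace a) j → Set) → Set
Extensional P = ∀ ts ts′ → (∀ p i → lookup ts p i ≡ lookup ts′ p i) → P ts → P ts′

combine-cong : ∀ {a j} {ts ts′ : Vec (Trace a) j} →
               (∀ p i → lookup ts p i ≡ lookup ts′ p i) → ∀ i → combine ts i ≡ combine ts′ i
combine-cong {ts = []}    {[]}    _        _ = refl
combine-cong {ts = _ ∷ _} {_ ∷ _} ts≗ts′ i =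
  cong₂ _∷_ (ts≗ts′ zero i) (combine-cong (ts≗ts′ ∘ suc) i)

combine-extensional : ∀ {j a} (ψ : LTL j a) → Extensional (λ ts → combine ts , 0 ⊨ ψ)
combine-extensional ψ ts ts′ ts≗ts′ = ⊨-resp (combine-cong ts≗ts′) ψ 0

Universal : Quant → Set
Universal q = T (not (isExists q))

module _ {a} (K : Kripke a) where
  open Kripke K

  path : (ℕ → Fin d) → ℕ → Maybe (Fin m)
  path e zero = nothing
  path e (suc r) = just (κ (path e r) (e r))

  trace : (ℕ → Fin d) → Trace a
  trace e r = ℓ (path e r)

  traces : ∀ {j} → (Fin j → ℕ → Fin d) → Vec (Trace a) j
  traces f = tabulate (λ p → trace (f p))

  path-cong : ∀ {e e′} → (∀ r → e r ≡ e′ r) → ∀ r → path e r ≡ path e′ r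
  path-cong e≗e′ zero = refl
  path-cong e≗e′ (suc r) = cong₂ (λ s x → just (κ s x)) (path-cong e≗e′ r) (e≗e′ r)

  trace-isTrace : ∀ e → IsTrace K (trace e)
  trace-isTrace e = path e , refl , (λ r → e r , refl) , (λ _ → refl)

  isTrace⇒trace : ∀ {t} → IsTrace K t → ∃ λ e → ∀ r → t r ≡ trace e r
  isTrace⇒trace (τ , τ0≡init , steps , t≗ℓτ) = e , λ r → trans (t≗ℓτ r) (cong ℓ (τ≗path r))
    where
    e : ℕ → Fin d
    e r = proj₁ (steps r)
    τ≗path : ∀ r → τ r ≡ path e r
    τ≗path zero = τ0≡init
    τ≗path (suc r) = trans (proj₂ (steps r)) (cong (λ s → just (κ s (e r))) (τ≗path r))

  labels≡combine : ∀ {j} (f : Fin j → ℕ → Fin d) r (ss : Vec (Maybe (Fin m)) j) →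
                   (∀ p → lookup ss p ≡ path (f p) r) → map ℓ ss ≡ combine (traces f) r
  labels≡combine f r ss ss≡ = begin
    map ℓ ss                               ≡⟨ cong (map ℓ) (tabulate∘lookup ss) ⟨
    map ℓ (tabulate (lookup ss))           ≡⟨ tabulate-∘ ℓ (lookup ss) ⟨
    tabulate (ℓ ∘ lookup ss)               ≡⟨ tabulate-cong (cong ℓ ∘ ss≡) ⟩
    tabulate (λ p → trace (f p) r)         ≡⟨ tabulate-∘ (λ t → t r) (λ p → trace (f p)) ⟩
    combine (traces f) r                   ∎
    where open ≡-Reasoning

  UniversalChoices : ∀ {j} → Vec Quant j → Set
  UniversalChoices {j} qs = (p : Fin j) → Universal (lookup qs p) → ℕ → Fin d

  AgreeUpTo : ∀ {j} {qs : Vec Quant j} → Fin j → UniversalChoices qs → UniversalChoices qs → Set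
  AgreeUpTo p D D′ = ∀ q → toℕ q ≤ toℕ p → ∀ u r → D q u r ≡ D′ q u r

  record CausalSkolem {j} (qs : Vec Quant j) (P : Vec (Trace a) j → Set) : Set where
    field
      choose    : UniversalChoices qs → Fin j → ℕ → Fin d
      satisfies : ∀ D → P (traces (choose D))
      follows   : ∀ D p u r → choose D p r ≡ D p u r
      causal    : ∀ D D′ p → AgreeUpTo {qs = qs} p D D′ → ∀ r → choose D p r ≡ choose D′ p r

  _◂_ : ∀ {Q j} {qs : Vec Quant j} → (Universal Q → ℕ → Fin d) → UniversalChoices qs →
        UniversalChoices (Q ∷ qs)
  (e ◂ D) zero = e
  (e ◂ D) (suc p) = D p

  extensional-∷ : ∀ {j} {P : Vec (Trace a) (suc j) → Set} t →
                  Extensional P → Extensional (λ ts → P (t ∷ ts))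
  extensional-∷ t ext ts ts′ ts≗ts′ =
    ext (t ∷ ts) (t ∷ ts′) λ { zero _ → refl ; (suc p) → ts≗ts′ p }

  skolem-tail : ∀ {Q j} {qs : Vec Quant j} {P} → Extensional P →
                (S : CausalSkolem (Q ∷ qs) P) →
                (e : Universal Q → ℕ → Fin d) (t : Trace a) →
                (∀ D r → trace (CausalSkolem.choose S (e ◂ D) zero) r ≡ t r) →
                CausalSkolem qs (λ ts → P (t ∷ ts))
  skolem-tail ext S e t head = record
    { choose    = λ D p → choose (e ◂ D) (suc p)
    ; satisfies = λ D → ext _ _ (λ { zero → head D ; (suc p) _ → refl }) (satisfies (e ◂ D))
    ; follows   = λ D p → follows (e ◂ D) (suc p)
    ; causal    = λ D D′ p agree → causal (e ◂ D) (e ◂ D′) (suc p)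
                    λ { zero _ _ _ → refl ; (suc q) (s≤s q≤p) → agree q q≤p }
    }
    where open CausalSkolem S

  -- The direction is only used to evaluate the Skolem function somewhere when
  -- instantiating an existential quantifier: K need not have any path.
  skolem⇒holds : Fin d → ∀ {j} (qs : Vec Quant j) {P} → Extensional P →
                 CausalSkolem qs P → Holds K qs P
  skolem⇒holds _ [] _ S = CausalSkolem.satisfies S (λ ())
  skolem⇒holds dir (∀q ∷ qs) ext S t t∈K =
    skolem⇒holds dir qs (extensional-∷ t ext) (skolem-tail ext S (λ _ → e) t head)
    where
    open CausalSkolem S
    e = proj₁ (isTrace⇒trace t∈K)
    head : ∀ D r → trace (choose ((λ _ → e) ◂ D) zero) r ≡ t r
    head D r = trans (cong ℓ (path-cong (follows _ zero tt) r)) (sym (proj₂ (isTrace⇒trace t∈K) r))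
  skolem⇒holds dir (∃q ∷ qs) ext S =
    t , trace-isTrace _ ,
    skolem⇒holds dir qs (extensional-∷ t ext) (skolem-tail ext S (λ ()) t head)
    where
    open CausalSkolem S
    D₀ : UniversalChoices (∃q ∷ qs)
    D₀ _ _ _ = dir
    t = trace (choose D₀ zero)
    head : ∀ D r → trace (choose ((λ ()) ◂ D) zero) r ≡ t r
    head D r = cong ℓ (path-cong (causal _ D₀ zero λ { zero _ () ; (suc _) () }) r)

module _ {n′ a : ℕ} (K : Kripke a) (φ : HyperLTL (suc n′) a) (𝒜 : DPA (suc n′) a) where
  open Kripke K
  open DPA 𝒜
  open HyperLTL φ
  open MPG (Game K φ 𝒜) using (V; owner; E; sim; Strategy; CStrat; hist; play; pick; Wins)

  private
    n : ℕ
    n = suc n′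

  states : V → Vec (Maybe (Fin m)) n
  states = proj₁

  autState : V → Fin nQ
  autState v = proj₁ (proj₂ v)

  owner-E : ∀ v dir → owner (E v dir) ≡ nxt (owner v)
  owner-E (_ , _ , zero) _ = refl
  owner-E (_ , _ , suc _) _ = refl

  states-E-owner : ∀ v dir {j} → j ≡ owner v →
                   lookup (states (E v dir)) j ≡ just (κ (lookup (states v) j) dir)
  states-E-owner (ss , _ , zero) _ refl = lookup∘updateAt zero ss
  states-E-owner (ss , _ , suc p) _ refl = lookup∘updateAt (suc p) ss

  states-E-other : ∀ v dir {j} → j ≢ owner v → lookup (states (E v dir)) j ≡ lookup (states v) j
  states-E-other (ss , _ , zero) _ j≢o = lookup∘updateAt′ _ zero j≢o ss
  states-E-other (ss , _ , suc p) _ j≢o = lookup∘updateAt′ _ (suc p) j≢o ss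

  autState-E-first : ∀ v dir → owner v ≡ zero →
                     autState (E v dir) ≡ δ (autState v) (map ℓ (states v))
  autState-E-first (_ , _ , zero) _ _ = refl

  autState-E-later : ∀ v dir → owner v ≢ zero → autState (E v dir) ≡ autState v
  autState-E-later (_ , _ , zero) _ o≢0 = ⊥-elim (o≢0 refl)
  autState-E-later (_ , _ , suc _) _ _ = refl

  Family : Set
  Family = Fin n → Strategy

  move : Family → ℕ → Fin d
  move σ i = σ (owner (play σ i)) (hist σ i)

  play-suc : ∀ σ i → play σ (suc i) ≡ E (play σ i) (move σ i)
  play-suc σ i = last-∷ʳ _ (hist σ i)

  owner-play : ∀ σ i → toℕ (owner (play σ i)) ≡ i % n
  owner-play σ zero = refl
  owner-play σ (suc i) = begin
    toℕ (owner (play σ (suc i)))          ≡⟨ cong (toℕ ∘ owner) (play-suc σ i) ⟩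
    toℕ (owner (E (play σ i) (move σ i))) ≡⟨ cong toℕ (owner-E _ _) ⟩
    toℕ (nxt (owner (play σ i)))          ≡⟨ toℕ-nxt _ ⟩
    suc (toℕ (owner (play σ i))) % n      ≡⟨ cong (λ k → suc k % n) (owner-play σ i) ⟩
    suc (i % n) % n                       ≡⟨ [1+m%n]%n≡[1+m]%n i n ⟩
    suc i % n                             ∎
    where open ≡-Reasoning

  owner-round : ∀ σ r p → owner (play σ (r * n + toℕ p)) ≡ p
  owner-round σ r p =
    toℕ-injective (trans (owner-play σ (r * n + toℕ p)) ([m*n+o]%n≡o r (toℕ<n p)))

  directions : Family → Fin n → ℕ → Fin d
  directions σ p r = σ p (hist σ (r * n + toℕ p))

  word : Family → ℕ → Letter n a
  word σ = combine (traces K (directions σ))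

  -- Round r consists of the steps r * n + s, s < n, in which the players
  -- move in turn; the automaton reads letter r when the first player moves.
  lettersRead : ℕ → ℕ → ℕ
  lettersRead r zero = r
  lettersRead r (suc _) = suc r

  r≤lettersRead : ∀ r s → r ≤ lettersRead r s
  r≤lettersRead r zero = ≤-refl
  r≤lettersRead r (suc _) = n≤1+n r

  record AtRound (σ : Family) (r s : ℕ) (v : V) : Set where
    field
      moved     : ∀ p → toℕ p < s → lookup (states v) p ≡ path K (directions σ p) (suc r)
      waiting   : ∀ p → s ≤ toℕ p → lookup (states v) p ≡ path K (directions σ p) r
      automaton : autState v ≡ run (word σ) (lettersRead r s)

  AtRound-start : ∀ σ → AtRound σ 0 0 (play σ 0)
  AtRound-start σ = record
    { moved = λ _ ()
    ; waiting = λ p _ → lookup-replicate p nothing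
    ; automaton = refl
    }

  AtRound-nextRound : ∀ {σ r v} → AtRound σ r n v → AtRound σ (suc r) 0 v
  AtRound-nextRound I = record
    { moved = λ _ ()
    ; waiting = λ p _ → moved p (toℕ<n p)
    ; automaton = automaton
    }
    where open AtRound I

  autState-E : ∀ σ r s v dir → toℕ (owner v) ≡ s → AtRound σ r s v →
               autState (E v dir) ≡ run (word σ) (lettersRead r (suc s))
  autState-E σ r zero v dir o≡0 I =
    trans (autState-E-first v dir (toℕ-injective o≡0))
          (cong₂ δ automaton (labels≡combine K (directions σ) r (states v) λ p → waiting p z≤n))
    where open AtRound I
  autState-E σ r (suc _) v dir o≡1+s I =
    trans (autState-E-later v dir (λ o≡0 → 0≢1+n (trans (sym (cong toℕ o≡0)) o≡1+s))) automaton
    where open AtRound I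

  AtRound-E : ∀ σ r s v → toℕ (owner v) ≡ s → AtRound σ r s v →
              AtRound σ r (suc s) (E v (directions σ (owner v) r))
  AtRound-E σ r s v o≡s I = record
    { moved = moved′ ; waiting = waiting′ ; automaton = autState-E σ r s v dir o≡s I }
    where
    open AtRound I
    o = owner v
    dir = directions σ o r
    moved′ : ∀ p → toℕ p < suc s → lookup (states (E v dir)) p ≡ path K (directions σ p) (suc r)
    moved′ p p<1+s with p ≟ᶠ o
    ... | yes refl =
      trans (states-E-owner v dir refl) (cong (λ x → just (κ x dir)) (waiting o (≤-reflexive (sym o≡s))))
    ... | no p≢o =
      trans (states-E-other v dir p≢o)
            (moved p (≤∧≢⇒< (≤-pred p<1+s) (λ p≡s → p≢o (toℕ-injective (trans p≡s (sym o≡s))))))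
    waiting′ : ∀ p → suc s ≤ toℕ p → lookup (states (E v dir)) p ≡ path K (directions σ p) r
    waiting′ p 1+s≤p =
      trans (states-E-other v dir (λ p≡o → <⇒≢ 1+s≤p (sym (trans (cong toℕ p≡o) o≡s))))
            (waiting p (≤-trans (n≤1+n s) 1+s≤p))

  play-round-step : ∀ σ r s → let v = play σ (r * n + s) in toℕ (owner v) ≡ s →
                    play σ (r * n + suc s) ≡ E v (directions σ (owner v) r)
  play-round-step σ r s o≡s = begin
    play σ (r * n + suc s)   ≡⟨ cong (play σ) (+-suc (r * n) s) ⟩
    play σ (suc (r * n + s)) ≡⟨ play-suc σ (r * n + s) ⟩
    E v (σ (owner v) (hist σ (r * n + s)))
      ≡⟨ cong (λ k → E v (σ (owner v) (hist σ (r * n + k)))) o≡s ⟨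
    E v (σ (owner v) (hist σ (r * n + toℕ (owner v)))) ∎
    where
    open ≡-Reasoning
    v = play σ (r * n + s)

  at-round : ∀ σ r s → s ≤ n → AtRound σ r s (play σ (r * n + s))
  at-round σ zero zero _ = AtRound-start σ
  at-round σ (suc r) zero _ =
    subst (AtRound σ (suc r) 0) (cong (play σ) r*n+n≡[1+r]*n+0)
      (AtRound-nextRound (at-round σ r n ≤-refl))
    where
    r*n+n≡[1+r]*n+0 : r * n + n ≡ suc r * n + 0
    r*n+n≡[1+r]*n+0 = trans (+-comm (r * n) n) (sym (+-identityʳ _))
  at-round σ r (suc s) s<n =
    subst (AtRound σ r (suc s)) (sym (play-round-step σ r s o≡s))
      (AtRound-E σ r s _ o≡s (at-round σ r s (<⇒≤ s<n)))
    where
    o≡s : toℕ (owner (play σ (r * n + s))) ≡ s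
    o≡s = trans (owner-play σ (r * n + s)) ([m*n+o]%n≡o r s<n)

  autState-play : ∀ σ i → autState (play σ i) ≡ run (word σ) (lettersRead (i / n) (i % n))
  autState-play σ i = trans (cong (autState ∘ play σ) (m≡[m/n]*n+m%n i n))
                            (AtRound.automaton (at-round σ (i / n) (i % n) (<⇒≤ (m%n<n i n))))

  even⇒accepts : ∀ σ → MinInfEven (λ i → c (autState (play σ i))) → Accepts (word σ)
  even⇒accepts σ = MinInfEven-transfer embed cofinal
    where
    embed : ∀ r → ∃ λ i → r ≤ i × c (autState (play σ i)) ≡ c (run (word σ) r)
    embed r =
      r * n + 0 , ≤-trans (m≤m*n r n) (m≤m+n _ 0) , cong c (AtRound.automaton (at-round σ r 0 z≤n))
    cofinal : ∀ r → ∃ λ k → ∀ i → k ≤ i →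
              ∃ λ r′ → r ≤ r′ × c (autState (play σ i)) ≡ c (run (word σ) r′)
    cofinal r = r * n , λ i r*n≤i →
      lettersRead (i / n) (i % n) , ≤-trans (m*n≤o⇒m≤o/n r r*n≤i) (r≤lettersRead _ _) ,
      cong c (autState-play σ i)

  Indistinguishable : Fin n → ∀ {k} → Vec V k → Vec V k → Set
  Indistinguishable p ρ ρ′ = ∀ i → sim p (lookup ρ i) (lookup ρ′ i)

  indistinguishable-antitone : ∀ {o p k} (ρ ρ′ : Vec V k) → toℕ o ≤ toℕ p →
                               Indistinguishable p ρ ρ′ → Indistinguishable o ρ ρ′
  indistinguishable-antitone _ _ o≤p ρ∼ρ′ i =
    proj₁ (ρ∼ρ′ i) , λ j j≤o → proj₂ (ρ∼ρ′ i) j (≤-trans j≤o o≤p)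

  -- Only the owner's component changes, so ∼ₚ survives a move that p cannot see.
  sim-E : ∀ {p} v v′ dir dir′ → sim p v v′ → (toℕ (owner v) ≤ toℕ p → dir ≡ dir′) →
          sim p (E v dir) (E v′ dir′)
  sim-E {p} v v′ dir dir′ (o≡o′ , ss≡ss′) dir≡dir′ = owners , states≡
    where
    owners : owner (E v dir) ≡ owner (E v′ dir′)
    owners = trans (owner-E v dir) (trans (cong nxt o≡o′) (sym (owner-E v′ dir′)))
    states≡ : ∀ j → toℕ j ≤ toℕ p → lookup (states (E v dir)) j ≡ lookup (states (E v′ dir′)) j
    states≡ j j≤p with j ≟ᶠ owner v
    ... | yes j≡o = begin
      lookup (states (E v dir)) j          ≡⟨ states-E-owner v dir j≡o ⟩
      just (κ (lookup (states v) j) dir)   ≡⟨ cong₂ (λ s x → just (κ s x)) (ss≡ss′ j j≤p) (dir≡dir′ o≤p) ⟩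
      just (κ (lookup (states v′) j) dir′) ≡⟨ states-E-owner v′ dir′ (trans j≡o o≡o′) ⟨
      lookup (states (E v′ dir′)) j        ∎
      where
      open ≡-Reasoning
      o≤p : toℕ (owner v) ≤ toℕ p
      o≤p = subst (λ o → toℕ o ≤ toℕ p) j≡o j≤p
    ... | no j≢o = begin
      lookup (states (E v dir)) j          ≡⟨ states-E-other v dir j≢o ⟩
      lookup (states v) j                  ≡⟨ ss≡ss′ j j≤p ⟩
      lookup (states v′) j                 ≡⟨ states-E-other v′ dir′ (j≢o ∘ λ j≡o′ → trans j≡o′ (sym o≡o′)) ⟨
      lookup (states (E v′ dir′)) j        ∎
      where open ≡-Reasoning

  hist-indistinguishable : ∀ p σ σ′ →
    (∀ i → Indistinguishable p (hist σ i) (hist σ′ i) →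
           toℕ (owner (play σ i)) ≤ toℕ p → move σ i ≡ move σ′ i) →
    ∀ i → Indistinguishable p (hist σ i) (hist σ′ i)
  hist-indistinguishable p σ σ′ same zero zero = refl , λ _ _ → refl
  hist-indistinguishable p σ σ′ same (suc i) =
    ∷ʳ-pointwise (sim p) (hist σ i) (hist σ′ i) ρ∼ρ′
      (sim-E (play σ i) (play σ′ i) (move σ i) (move σ′ i)
        (last-pointwise (sim p) (hist σ i) (hist σ′ i) ρ∼ρ′) (same i ρ∼ρ′))
    where
    ρ∼ρ′ = hist-indistinguishable p σ σ′ same i

  pick-no : ∀ {X : Set} b (f : T b → X) g (u : T (not b)) → pick b f g ≡ g u
  pick-no false _ _ _ = refl

  pick-agree : ∀ {o} b (f : T b → CStrat o) (g g′ : T (not b) → CStrat o) {k} (ρ ρ′ : Vec V (suc k)) →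
               owner (last ρ) ≡ o → Indistinguishable o ρ ρ′ →
               (∀ u → proj₁ (g u) ρ ≡ proj₁ (g′ u) ρ′) →
               proj₁ (pick b f g) ρ ≡ proj₁ (pick b f g′) ρ′
  pick-agree true f _ _ ρ ρ′ own ρ∼ρ′ _ = proj₂ (f tt) ρ ρ′ own ρ∼ρ′
  pick-agree false _ _ _ _ _ _ _ g≡g′ = g≡g′ tt

  coalition : Fin n → Bool
  coalition p = isExists (lookup quants p)

  module _ (σ∃ : (p : Fin n) → T (coalition p) → CStrat p) where

    -- A universal player replays a fixed direction sequence, one entry per round.
    opponent : UniversalChoices K quants → (p : Fin n) → T (not (coalition p)) → CStrat p
    opponent D p u = (λ {k} _ → D p u (k / n)) , λ _ _ _ _ → refl

    profile : UniversalChoices K quants → Family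
    profile D p = proj₁ (pick (coalition p) (σ∃ p) (opponent D p))

    profile-opponent : ∀ D p u {k} (ρ : Vec V (suc k)) → profile D p ρ ≡ D p u (k / n)
    profile-opponent D p u ρ =
      cong (λ (s : CStrat p) → proj₁ s ρ) (pick-no (coalition p) (σ∃ p) (opponent D p) u)

    directions-universal : ∀ D p u r → directions (profile D) p r ≡ D p u r
    directions-universal D p u r =
      trans (profile-opponent D p u _) (cong (D p u) ([m*n+o]/n≡m r (toℕ<n p)))

    module _ (D D′ : UniversalChoices K quants) (p : Fin n) (agree : AgreeUpTo K {qs = quants} p D D′) where
      σ = profile D
      σ′ = profile D′

      same-move : ∀ i → Indistinguishable p (hist σ i) (hist σ′ i) →
                  toℕ (owner (play σ i)) ≤ toℕ p → move σ i ≡ move σ′ i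
      same-move i ρ∼ρ′ o≤p = trans same-choice (cong (λ o′ → σ′ o′ (hist σ′ i)) same-owner)
        where
        o = owner (play σ i)
        same-owner : o ≡ owner (play σ′ i)
        same-owner = proj₁ (last-pointwise (sim p) (hist σ i) (hist σ′ i) ρ∼ρ′)
        same-choice : σ o (hist σ i) ≡ σ′ o (hist σ′ i)
        same-choice =
          pick-agree (coalition o) (σ∃ o) (opponent D o) (opponent D′ o) (hist σ i) (hist σ′ i) refl
            (indistinguishable-antitone (hist σ i) (hist σ′ i) o≤p ρ∼ρ′) (λ u → agree o o≤p u (i / n))

      directions-causal : ∀ r → directions σ p r ≡ directions σ′ p r
      directions-causal r =
        pick-agree (coalition p) (σ∃ p) (opponent D p) (opponent D′ p) (hist σ i) (hist σ′ i)
          (owner-round σ r p) (hist-indistinguishable p σ σ′ same-move i) (λ u → agree p ≤-refl u (i / n))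
        where i = r * n + toℕ p

  winning⇒skolem : Recognizes 𝒜 body → Wins coalition →
                   CausalSkolem K quants (λ ts → combine ts , 0 ⊨ body)
  winning⇒skolem recognizes (σ∃ , wins) = record
    { choose    = λ D → directions (profile σ∃ D)
    ; satisfies = λ D → proj₁ (recognizes _) (even⇒accepts (profile σ∃ D) (wins (opponent σ∃ D)))
    ; follows   = directions-universal σ∃
    ; causal    = directions-causal σ∃
    }

theorem1 : ∀ {n' a : ℕ} (K : Kripke a) (φ : HyperLTL (suc n') a) (𝒜 : DPA (suc n') a) →
           Recognizes 𝒜 (HyperLTL.body φ) →
           MPG.Wins (Game K φ 𝒜) (λ i → isExists (lookup (HyperLTL.quants φ) i)) →
           K ⊨ₕ φ
theorem1 K φ@((∃q ∷ _) ∙ ψ) 𝒜 recognizes wins =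
  skolem⇒holds K first-move _ (combine-extensional ψ) (winning⇒skolem K φ 𝒜 recognizes wins)
  where first-move = proj₁ (proj₁ wins zero tt) (MPG.vinit (Game K φ 𝒜) ∷ [])
theorem1 K φ@((∀q ∷ _) ∙ ψ) 𝒜 recognizes wins t t∈K =
  skolem⇒holds K first-direction _ (combine-extensional ψ) (winning⇒skolem K φ 𝒜 recognizes wins) t t∈K
  where first-direction = proj₁ (isTrace⇒trace K t∈K) 0
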